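{- Let $n \ge 5$, $k = \lfloor n/2 \rfloor$ and $k' = \lceil n/2 \rceil$. Starting from $K'_{k,n} = (k', k'-1, \ldots, 2, 1, k'+1, k'+2, \ldots, n)$ and applying, in order, $E$, then $(LE)^{k'-2}$, then $(RE)^{k'-2}$, yields the permutation $(1, k'-1, k'-2, \ldots, 2, k', k'+1, \ldots, n-1, n)$. The number of moves applied is $2n-7$ if $n$ is even and $2n-5$ if $n$ is odd.
   Context: Permutations of $\{1,\ldots,n\}$ are written as sequences $(a_1,\ldots,a_n)$. The LRE moves are: $L$ (left rotate), $(a_1,\ldots,a_n)\mapsto(a_2,\ldots,a_n,a_1)$; $R$ (right rotate), $(a_1,\ldots,a_n)\mapsto(a_n,a_1,\ldots,a_{n-1})$; $E$ (exchange), $(a_1,a_2,a_3,\ldots,a_n)\mapsto(a_2,a_1,a_3,\ldots,a_n)$. Moves are applied one after another in the order written. $LE$ denotes an $L$ move followed by an $E$ move and $RE$ an $R$ move followed by an $E$ move; $(LE)^p$, $(RE)^p$ denote $p$ consecutive repetitions. For $1\le r\le n$, $K'_{r,n}$ is the permutation $(n-r, n-r-1, \ldots, 2, 1, n-r+1, n-r+2, \ldots, n)$, i.e. the smallest $n-r$ values in decreasing order followed by the largest $r$ values in increasing order. -}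

module Defs where

open import Data.Nat using (ℕ; zero; suc; _+_; _∸_)
open import Data.List using (List; []; _∷_; _++_; reverse; concat; replicate)

-- A permutation of {1,…,n} is written as the sequence (a₁,…,aₙ), a list.
data Move : Set where
  L R E : Move

moveL : List ℕ → List ℕ
moveL []       = []
moveL (a ∷ as) = as ++ (a ∷ [])

moveR : List ℕ → List ℕ
moveR xs = reverse (moveL (reverse xs))

moveE : List ℕ → List ℕ
moveE (a ∷ b ∷ as) = b ∷ a ∷ as
moveE xs           = xs

applyMove : Move → List ℕ → List ℕ
applyMove L = moveL
applyMove R = moveR
applyMove E = moveE

applyMoves : List Move → List ℕ → List ℕ
applyMoves []       xs = xs
applyMoves (m ∷ ms) xs = applyMoves ms (applyMove m xs)

_^^_ : List Move → ℕ → List Move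
w ^^ p = concat (replicate p w)

incr : ℕ → ℕ → List ℕ
incr a zero    = []
incr a (suc c) = a ∷ incr (suc a) c

K' : ℕ → ℕ → List ℕ
K' r n = reverse (incr 1 (n ∸ r)) ++ incr (suc (n ∸ r)) r

-- After E the sequence is (k'-1, k', k'-2, …, 1, k'+1, …, n).  Each LE keeps the second
-- entry k' in place while carrying the head to the back, so (LE)^(k'-2) moves k'-1, …, 2
-- behind n and brings 1 to the front.  Each RE keeps the head 1 in place and brings the
-- last entry to the second position, so (RE)^(k'-2) carries the block k'-1, …, 2 back in
-- front of k'.  The word has 1 + 4(k'-2) letters, with 2k' = n or n + 1.
module Submission where

open import Defs
open import Data.Nat using (ℕ; zero; suc; _≤_; _+_; _*_; _∸_; _%_; ⌊_/2⌋; ⌈_/2⌉; s≤s; z≤n)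
open import Data.Nat.Properties
  using (+-identityʳ; +-suc; +-comm; *-distribˡ-+; m+n∸m≡n; m+n∸n≡m; ≤-trans; ⌈n/2⌉-mono; ⌊n/2⌋+⌈n/2⌉≡n)
open import Data.Nat.Solver using (module +-*-Solver)
open import Data.List using (List; []; _∷_; _++_; _∷ʳ_; reverse; length)
open import Data.List.Properties using (++-identityʳ; ++-assoc; length-++; length-reverse; unfold-reverse; reverse-++; reverse-involutive)
open import Data.Product using (_×_; _,_)
open import Relation.Binary.PropositionalEquality using (_≡_; refl; sym; trans; cong; cong₂; module ≡-Reasoning)
open ≡-Reasoning
open +-*-Solver using (solve; _:+_; _:*_; _:=_; con)

LE RE : List Move
LE = L ∷ E ∷ []
RE = R ∷ E ∷ []

exchangeRotations : ℕ → List Move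
exchangeRotations j = (E ∷ []) ++ (LE ^^ j) ++ (RE ^^ j)

applyMoves-++ : ∀ ms ms′ xs → applyMoves (ms ++ ms′) xs ≡ applyMoves ms′ (applyMoves ms xs)
applyMoves-++ []       ms′ xs = refl
applyMoves-++ (m ∷ ms) ms′ xs = applyMoves-++ ms ms′ (applyMove m xs)

length-^^ : ∀ (w : List Move) p → length (w ^^ p) ≡ p * length w
length-^^ w zero    = refl
length-^^ w (suc p) = trans (length-++ w) (cong (length w +_) (length-^^ w p))

length-exchangeRotations : ∀ j → length (exchangeRotations j) ≡ 1 + 4 * j
length-exchangeRotations j = begin
  suc (length (LE ^^ j ++ RE ^^ j))
    ≡⟨ cong suc (length-++ (LE ^^ j)) ⟩
  suc (length (LE ^^ j) + length (RE ^^ j))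
    ≡⟨ cong suc (cong₂ _+_ (length-^^ LE j) (length-^^ RE j)) ⟩
  suc (j * 2 + j * 2)
    ≡⟨ solve 1 (λ j → con 1 :+ (j :* con 2 :+ j :* con 2) := con 1 :+ con 4 :* j) refl j ⟩
  1 + 4 * j  ∎

-- LE fixes the second entry, sends the first to the back and brings the third to the front.
applyMoves-LE^^ : ∀ b a Q c Z →
  applyMoves (LE ^^ suc (length Q)) (a ∷ b ∷ Q ++ c ∷ Z) ≡ c ∷ b ∷ Z ++ a ∷ Q
applyMoves-LE^^ b a []      c Z = refl
applyMoves-LE^^ b a (q ∷ Q) c Z = begin
  applyMoves (LE ^^ suc (length Q)) (q ∷ b ∷ (Q ++ c ∷ Z) ++ a ∷ [])
    ≡⟨ cong (λ xs → applyMoves (LE ^^ suc (length Q)) (q ∷ b ∷ xs)) (++-assoc Q (c ∷ Z) (a ∷ [])) ⟩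
  applyMoves (LE ^^ suc (length Q)) (q ∷ b ∷ Q ++ c ∷ Z ++ a ∷ [])
    ≡⟨ applyMoves-LE^^ b q Q c (Z ++ a ∷ []) ⟩
  c ∷ b ∷ (Z ++ a ∷ []) ++ q ∷ Q
    ≡⟨ cong (λ xs → c ∷ b ∷ xs) (++-assoc Z (a ∷ []) (q ∷ Q)) ⟩
  c ∷ b ∷ Z ++ a ∷ q ∷ Q  ∎

moveR-∷ʳ : ∀ xs x → moveR (xs ∷ʳ x) ≡ x ∷ xs
moveR-∷ʳ xs x = begin
  reverse (moveL (reverse (xs ∷ʳ x)))  ≡⟨ cong (λ ys → reverse (moveL ys)) (reverse-++ xs (x ∷ [])) ⟩
  reverse (reverse xs ∷ʳ x)            ≡⟨ reverse-++ (reverse xs) (x ∷ []) ⟩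
  x ∷ reverse (reverse xs)             ≡⟨ cong (x ∷_) (reverse-involutive xs) ⟩
  x ∷ xs  ∎

-- RE fixes the first entry and moves the last one to the second position.
applyMoves-RE^^ : ∀ a C Q → applyMoves (RE ^^ length Q) (a ∷ C ++ reverse Q) ≡ a ∷ reverse Q ++ C
applyMoves-RE^^ a C []      = cong (a ∷_) (++-identityʳ C)
applyMoves-RE^^ a C (q ∷ Q) = begin
  applyMoves (RE ^^ suc (length Q)) (a ∷ C ++ reverse (q ∷ Q))
    ≡⟨ cong (λ xs → applyMoves (RE ^^ suc (length Q)) (a ∷ xs))
            (trans (cong (C ++_) (unfold-reverse q Q)) (sym (++-assoc C (reverse Q) (q ∷ [])))) ⟩
  applyMoves (RE ^^ suc (length Q)) ((a ∷ C ++ reverse Q) ∷ʳ q)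
    ≡⟨ cong (λ xs → applyMoves (RE ^^ length Q) (moveE xs)) (moveR-∷ʳ (a ∷ C ++ reverse Q) q) ⟩
  applyMoves (RE ^^ length Q) (a ∷ (q ∷ C) ++ reverse Q)
    ≡⟨ applyMoves-RE^^ a (q ∷ C) Q ⟩
  a ∷ reverse Q ++ q ∷ C
    ≡⟨ cong (a ∷_) (trans (sym (++-assoc (reverse Q) (q ∷ []) C)) (cong (_++ C) (sym (unfold-reverse q Q)))) ⟩
  a ∷ reverse (q ∷ Q) ++ C  ∎

length-incr : ∀ a j → length (incr a j) ≡ j
length-incr a zero    = refl
length-incr a (suc j) = cong suc (length-incr (suc a) j)

incr-suc : ∀ a j → incr a (suc j) ≡ incr a j ∷ʳ (a + j)
incr-suc a zero    = cong (λ x → x ∷ []) (sym (+-identityʳ a))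
incr-suc a (suc j) = cong (a ∷_) (trans (incr-suc (suc a) j) (cong (incr (suc a) j ∷ʳ_) (sym (+-suc a j))))

reverse-incr-suc : ∀ a j → reverse (incr a (suc j)) ≡ a + j ∷ reverse (incr a j)
reverse-incr-suc a j = trans (cong reverse (incr-suc a j)) (reverse-++ (incr a j) (a + j ∷ []))

applyMoves-exchangeRotations : ∀ j T →
  applyMoves (exchangeRotations j) (reverse (incr 1 (2 + j)) ++ T) ≡ 1 ∷ reverse (incr 2 j) ++ 2 + j ∷ T
applyMoves-exchangeRotations zero    T = refl
applyMoves-exchangeRotations (suc i) T = begin
  applyMoves (exchangeRotations (suc i)) (reverse (incr 1 (3 + i)) ++ T)
    ≡⟨ cong (applyMoves (exchangeRotations (suc i))) descending ⟩
  applyMoves (LE ^^ suc i ++ RE ^^ suc i) (2 + i ∷ 3 + i ∷ Q ++ 1 ∷ T)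
    ≡⟨ applyMoves-++ (LE ^^ suc i) (RE ^^ suc i) (2 + i ∷ 3 + i ∷ Q ++ 1 ∷ T) ⟩
  applyMoves (RE ^^ suc i) (applyMoves (LE ^^ suc i) (2 + i ∷ 3 + i ∷ Q ++ 1 ∷ T))
    ≡⟨ cong (λ p → applyMoves (RE ^^ suc i) (applyMoves (LE ^^ suc p) (2 + i ∷ 3 + i ∷ Q ++ 1 ∷ T))) (sym length-Q) ⟩
  applyMoves (RE ^^ suc i) (applyMoves (LE ^^ suc (length Q)) (2 + i ∷ 3 + i ∷ Q ++ 1 ∷ T))
    ≡⟨ cong (applyMoves (RE ^^ suc i)) (applyMoves-LE^^ (3 + i) (2 + i) Q 1 T) ⟩
  applyMoves (RE ^^ suc i) (1 ∷ (3 + i ∷ T) ++ 2 + i ∷ Q)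
    ≡⟨ cong₂ (λ p xs → applyMoves (RE ^^ p) (1 ∷ (3 + i ∷ T) ++ xs))
             (sym (length-incr 2 (suc i))) (sym (reverse-incr-suc 2 i)) ⟩
  applyMoves (RE ^^ length (incr 2 (suc i))) (1 ∷ (3 + i ∷ T) ++ reverse (incr 2 (suc i)))
    ≡⟨ applyMoves-RE^^ 1 (3 + i ∷ T) (incr 2 (suc i)) ⟩
  1 ∷ reverse (incr 2 (suc i)) ++ 3 + i ∷ T  ∎
  where
  Q : List ℕ
  Q = reverse (incr 2 i)

  length-Q : length Q ≡ i
  length-Q = trans (length-reverse (incr 2 i)) (length-incr 2 i)

  descending : reverse (incr 1 (3 + i)) ++ T ≡ 3 + i ∷ 2 + i ∷ Q ++ 1 ∷ T
  descending = begin
    reverse (incr 1 (3 + i)) ++ T              ≡⟨ cong (_++ T) (reverse-incr-suc 1 (2 + i)) ⟩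
    3 + i ∷ reverse (incr 1 (2 + i)) ++ T      ≡⟨ cong (λ xs → 3 + i ∷ xs ++ T) (reverse-incr-suc 1 (suc i)) ⟩
    3 + i ∷ 2 + i ∷ reverse (incr 1 (1 + i)) ++ T
      ≡⟨ cong (λ xs → 3 + i ∷ 2 + i ∷ xs ++ T) (unfold-reverse 1 (incr 2 i)) ⟩
    3 + i ∷ 2 + i ∷ (Q ∷ʳ 1) ++ T              ≡⟨ cong (λ xs → 3 + i ∷ 2 + i ∷ xs) (++-assoc Q (1 ∷ []) T) ⟩
    3 + i ∷ 2 + i ∷ Q ++ 1 ∷ T  ∎

K'-split : ∀ k m → K' k (k + m) ≡ reverse (incr 1 m) ++ incr (suc m) k
K'-split k m = cong (λ r → reverse (incr 1 r) ++ incr (suc r) k) (m+n∸m≡n k m)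

applyMoves-exchangeRotations-K' : ∀ n k m → k + m ≡ n → 2 ≤ m →
  applyMoves (exchangeRotations (m ∸ 2)) (K' k n) ≡ 1 ∷ reverse (incr 2 (m ∸ 2)) ++ incr m (n ∸ m + 1)
applyMoves-exchangeRotations-K' _ k (suc zero)    _    (s≤s ())
applyMoves-exchangeRotations-K' _ k (suc (suc j)) refl _ = begin
  applyMoves (exchangeRotations j) (K' k (k + (2 + j)))
    ≡⟨ cong (applyMoves (exchangeRotations j)) (K'-split k (2 + j)) ⟩
  applyMoves (exchangeRotations j) (reverse (incr 1 (2 + j)) ++ incr (3 + j) k)
    ≡⟨ applyMoves-exchangeRotations j (incr (3 + j) k) ⟩
  1 ∷ reverse (incr 2 j) ++ incr (2 + j) (1 + k)
    ≡⟨ cong (λ c → 1 ∷ reverse (incr 2 j) ++ incr (2 + j) c)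
            (sym (trans (cong (_+ 1) (m+n∸n≡m k (2 + j))) (+-comm k 1))) ⟩
  1 ∷ reverse (incr 2 j) ++ incr (2 + j) (k + (2 + j) ∸ (2 + j) + 1)  ∎

length-exchangeRotations-∸2 : ∀ m → 2 ≤ m → length (exchangeRotations (m ∸ 2)) ≡ 2 * (m + m) ∸ 7
length-exchangeRotations-∸2 (suc zero)    (s≤s ())
length-exchangeRotations-∸2 (suc (suc j)) _ = begin
  length (exchangeRotations j)       ≡⟨ length-exchangeRotations j ⟩
  1 + 4 * j                          ≡⟨ sym (m+n∸m≡n 7 (1 + 4 * j)) ⟩
  7 + (1 + 4 * j) ∸ 7                ≡⟨ cong (_∸ 7) (solve 1 (λ j → con 7 :+ (con 1 :+ con 4 :* j)
                                                          := con 2 :* ((con 2 :+ j) :+ (con 2 :+ j))) refl j) ⟩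
  2 * (2 + j + (2 + j)) ∸ 7  ∎

⌈n/2⌉+⌈n/2⌉≡n+n%2 : ∀ n → ⌈ n /2⌉ + ⌈ n /2⌉ ≡ n + n % 2
⌈n/2⌉+⌈n/2⌉≡n+n%2 zero          = refl
⌈n/2⌉+⌈n/2⌉≡n+n%2 (suc zero)    = refl
⌈n/2⌉+⌈n/2⌉≡n+n%2 (suc (suc n)) =
  cong suc (trans (+-suc ⌈ n /2⌉ ⌈ n /2⌉) (cong suc (⌈n/2⌉+⌈n/2⌉≡n+n%2 n)))

lemma5 : (n : ℕ) → 5 ≤ n →
    let k  = ⌊ n /2⌋
        k' = ⌈ n /2⌉
        ms = (E ∷ []) ++ ((L ∷ E ∷ []) ^^ (k' ∸ 2)) ++ ((R ∷ E ∷ []) ^^ (k' ∸ 2))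
    in (applyMoves ms (K' k n)
          ≡ 1 ∷ reverse (incr 2 (k' ∸ 2)) ++ incr k' (n ∸ k' + 1))
       × (n % 2 ≡ 0 → length ms ≡ 2 * n ∸ 7)
       × (n % 2 ≡ 1 → length ms ≡ 2 * n ∸ 5)
lemma5 n 5≤n =
  applyMoves-exchangeRotations-K' n ⌊ n /2⌋ ⌈ n /2⌉ (⌊n/2⌋+⌈n/2⌉≡n n) 2≤⌈n/2⌉ , even , odd
  where
  2≤⌈n/2⌉ : 2 ≤ ⌈ n /2⌉
  2≤⌈n/2⌉ = ⌈n/2⌉-mono (≤-trans (s≤s (s≤s (s≤s z≤n))) 5≤n)

  length-ms : length (exchangeRotations (⌈ n /2⌉ ∸ 2)) ≡ 2 * (n + n % 2) ∸ 7
  length-ms = trans (length-exchangeRotations-∸2 ⌈ n /2⌉ 2≤⌈n/2⌉) (cong (λ x → 2 * x ∸ 7) (⌈n/2⌉+⌈n/2⌉≡n+n%2 n))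

  even : n % 2 ≡ 0 → length (exchangeRotations (⌈ n /2⌉ ∸ 2)) ≡ 2 * n ∸ 7
  even n%2≡0 = trans length-ms (cong (λ x → 2 * x ∸ 7) (trans (cong (n +_) n%2≡0) (+-identityʳ n)))

  -- (2 + x) ∸ 7 reduces to x ∸ 5.
  odd : n % 2 ≡ 1 → length (exchangeRotations (⌈ n /2⌉ ∸ 2)) ≡ 2 * n ∸ 5
  odd n%2≡1 = trans length-ms (cong (_∸ 7) (trans (cong (2 *_) (cong (n +_) n%2≡1))
                                                  (trans (*-distribˡ-+ 2 n 1) (+-comm (2 * n) 2))))
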